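{- Let $c$ be a real or complex number, $\underline{c}=(c,c,c,\dots)$, and $k\ge0$ an integer. Let $A(x,c)=\sum_{n\ge0}a_{n,0}(\underline{c})x^n$ and define $b_{n,k}(\underline{c})$ by $\frac{1}{A(x,c)^{k+1}}=\sum_{n\ge0}b_{n,k}(\underline{c})x^n$ (as formal power series). Then for every integer $n\ge0$, $$d_{0,k,n+1}(\underline{c}):=\det\left(b_{i+j,k}(\underline{c})\right)_{i,j=0}^{n}=(-1)^n D_{k+2,k,n}(\underline{c}).$$
   Context: For a sequence $\mathbf{s}=(s_k)_{k\ge0}$ define numbers $a_{n,k}(\mathbf{s})$ for $n\ge 0$, $k\in\mathbb{Z}$ by $a_{0,k}(\mathbf{s})=[k=0]$ (i.e. $1$ if $k=0$, else $0$), $a_{n,k}(\mathbf{s})=0$ for $k<0$, and for $n\ge1$, $k\ge 0$: $a_{n,k}(\mathbf{s})=a_{n-1,k-1}(\mathbf{s})+s_k\,a_{n-1,k}(\mathbf{s})+a_{n-1,k+1}(\mathbf{s})$. For integers $m$, $k\ge0$, $n\ge 0$ define $D_{m,k,n}(\mathbf{s})=\det\left(a_{i+j+m,k}(\mathbf{s})\right)_{i,j=0}^{n-1}$, with $D_{m,k,0}(\mathbf{s})=1$. Since $a_{0,0}(\underline{c})=1$, $A(x,c)$ is an invertible formal power series. -}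

module Defs where

open import Level using (Level)
open import Data.Nat using (ℕ; zero; suc; _∸_) renaming (_+_ to _+ℕ_)
open import Data.Fin using (Fin; zero; suc; toℕ; punchIn)
open import Algebra.Bundles using (CommutativeRing)

module _ {r ℓ : Level} (R : CommutativeRing r ℓ) where
  open CommutativeRing R using (Carrier; _≈_; _+_; _*_; -_; 0#; 1#)

  -- The numbers a_{n,k}(s) for a sequence s, with k ≥ 0 (a_{n,k} = 0 for k < 0
  -- is built in: the a_{n-1,k-1} term is omitted when k = 0).
  aSeq : (ℕ → Carrier) → ℕ → ℕ → Carrier
  aSeq s zero    zero    = 1#
  aSeq s zero    (suc k) = 0#
  aSeq s (suc n) zero    = s zero * aSeq s n zero + aSeq s n 1
  aSeq s (suc n) (suc k) =
    aSeq s n k + s (suc k) * aSeq s n (suc k) + aSeq s n (suc (suc k))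

  constSeq : Carrier → ℕ → Carrier
  constSeq x _ = x

  sumFin : (n : ℕ) → (Fin n → Carrier) → Carrier
  sumFin zero    f = 0#
  sumFin (suc n) f = f zero + sumFin n (λ i → f (suc i))

  negOnePow : ℕ → Carrier
  negOnePow zero    = 1#
  negOnePow (suc n) = - negOnePow n

  det : (n : ℕ) → (Fin n → Fin n → Carrier) → Carrier
  det zero    M = 1#
  det (suc n) M =
    sumFin (suc n) (λ j → negOnePow (toℕ j) * (M zero j *
      det n (λ i l → M (suc i) (punchIn j l))))

  D : ℕ → ℕ → ℕ → (ℕ → Carrier) → Carrier
  D m k n s = det n (λ i j → aSeq s (toℕ i +ℕ toℕ j +ℕ m) k)

  sumTo : ℕ → (ℕ → Carrier) → Carrier
  sumTo zero    f = 0#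
  sumTo (suc n) f = sumTo n f + f n

  _⋆_ : (ℕ → Carrier) → (ℕ → Carrier) → ℕ → Carrier
  (f ⋆ g) n = sumTo (suc n) (λ i → f i * g (n ∸ i))

  oneSeries : ℕ → Carrier
  oneSeries zero    = 1#
  oneSeries (suc n) = 0#

  powSeries : (ℕ → Carrier) → ℕ → ℕ → Carrier
  powSeries f zero    = oneSeries
  powSeries f (suc m) = f ⋆ powSeries f m

  Aser : Carrier → ℕ → Carrier
  Aser x n = aSeq (constSeq x) n zero

  IsInvPowA : Carrier → ℕ → (ℕ → Carrier) → Set ℓ
  IsInvPowA x k b = ∀ n → (powSeries (Aser x) (suc k) ⋆ b) n ≈ oneSeries n

-- Put f = A(x,c)^{k+1}, so that b = 1/f.  Splitting a path at its last visit to height 0 shows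
-- that a_{n+1,j+1} is the Cauchy product of (a_{m,0})_m and (a_{m,j})_m, and hence f_m = a_{m+k,k}.
-- Multiplying the Hankel matrix (b_{i+j}) on the left by the lower unitriangular Toeplitz matrix
-- of f does not change its determinant; since f b = 1 the first column becomes (1,0,…,0), and
-- splitting the relation (f b)_{i+j+2} = 0 shows that the remaining block is minus the transpose
-- of the Toeplitz matrix of b times (f_{i+j+2}).  A second unitriangular factor disappears in the
-- same way, leaving (-1)^n det (f_{i+j+2}) = (-1)^n D_{k+2,k,n}.
module Submission where

open import Level using (Level)
open import Function using (_∘_)
open import Data.Nat using (ℕ; zero; suc; _∸_; _<_; z≤n; s≤s) renaming (_+_ to _+ℕ_)
import Data.Nat.Properties as ℕ
open import Data.Fin using (Fin; zero; suc; toℕ; punchIn)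
open import Data.Vec.Functional using (_∷_)
open import Relation.Binary.PropositionalEquality as ≡ using (_≡_; _≗_)
open import Algebra.Bundles using (CommutativeRing)
open import Defs hiding (sumTo; _⋆_)
import Defs

module _ {r ℓ : Level} (R : CommutativeRing r ℓ) where
  open CommutativeRing R hiding (zero)
  open import Algebra.Properties.Ring ring
    using (-‿distribˡ-*; -‿distribʳ-*; -‿involutive; +-inverseˡ-unique)
  open import Algebra.Properties.Semiring.Sum semiring
    using (sum; sum-syntax; sum-cong-≋; sum-cong-≗; ∑-distrib-+; ∑-comm; *-distribˡ-sum; sum-replicate-zero)
  open import Algebra.Properties.CommutativeSemigroup *-commutativeSemigroup using (x∙yz≈y∙xz)
  open import Algebra.Properties.CommutativeSemigroup +-commutativeSemigroup
    using () renaming (interchange to +-interchange)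
  open import Algebra.Solver.CommutativeMonoid *-commutativeMonoid using (solve; _⊜_) renaming (_⊕_ to _⊗_)
  open import Relation.Binary.Reasoning.Setoid setoid

  -x*-y≈x*y : ∀ x y → - x * - y ≈ x * y
  -x*-y≈x*y x y =
    trans (sym (-‿distribʳ-* (- x) y)) (trans (-‿cong (sym (-‿distribˡ-* x y))) (-‿involutive _))

  -‿*-cong : ∀ {a b x y} → a * x ≈ b * y → - a * x ≈ - b * y
  -‿*-cong {a} {b} {x} {y} ax≈by =
    trans (sym (-‿distribˡ-* a x)) (trans (-‿cong ax≈by) (-‿distribˡ-* b y))

  sum-zero : ∀ n {f : Fin n → Carrier} → (∀ i → f i ≈ 0#) → sum f ≈ 0#
  sum-zero n f≈0 = trans (sum-cong-≋ f≈0) (sum-replicate-zero n)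

  *-*-distribˡ-sum : ∀ {n} x y (f : Fin n → Carrier) → x * (y * sum f) ≈ ∑[ i < n ] (x * (y * f i))
  *-*-distribˡ-sum x y f = trans (*-congˡ (*-distribˡ-sum y f)) (*-distribˡ-sum x (λ i → y * f i))

  -- Determinants

  Matrix : ℕ → Set r
  Matrix n = Fin n → Fin n → Carrier

  infix 10 _ᵀ
  _ᵀ : ∀ {n} → Matrix n → Matrix n
  (M ᵀ) i j = M j i

  minor : ∀ {n} → Fin (suc n) → Matrix (suc n) → Matrix n
  minor j M i l = M (suc i) (punchIn j l)

  sgn : ∀ {n} → Fin n → Carrier
  sgn j = negOnePow R (toℕ j)

  sumFin≡sum : ∀ n (f : Fin n → Carrier) → sumFin R n f ≡ sum f
  sumFin≡sum zero    f = ≡.refl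
  sumFin≡sum (suc n) f = ≡.cong (f zero +_) (sumFin≡sum n (f ∘ suc))

  det-laplace : ∀ n (M : Matrix (suc n)) →
    det R (suc n) M ≡ ∑[ j < suc n ] (sgn j * (M zero j * det R n (minor j M)))
  det-laplace n M = sumFin≡sum (suc n) (λ j → sgn j * (M zero j * det R n (minor j M)))

  det-cong-minors : ∀ n {M N : Matrix (suc n)} → (∀ j → M zero j ≈ N zero j) →
    (∀ j → det R n (minor j M) ≈ det R n (minor j N)) → det R (suc n) M ≈ det R (suc n) N
  det-cong-minors n {M} {N} row₀ minors = begin
    det R (suc n) M                                              ≡⟨ det-laplace n M ⟩
    ∑[ j < suc n ] (sgn j * (M zero j * det R n (minor j M)))
      ≈⟨ sum-cong-≋ (λ j → *-congˡ {sgn j} (*-cong (row₀ j) (minors j))) ⟩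
    ∑[ j < suc n ] (sgn j * (N zero j * det R n (minor j N)))  ≡⟨ det-laplace n N ⟨
    det R (suc n) N                                              ∎

  det-cong : ∀ n {M N : Matrix n} → (∀ i j → M i j ≈ N i j) → det R n M ≈ det R n N
  det-cong zero    M≈N = refl
  det-cong (suc n) {M} {N} M≈N =
    det-cong-minors n {M} {N} (M≈N zero) (λ j → det-cong n (λ i l → M≈N (suc i) (punchIn j l)))

  det-neg : ∀ n (M : Matrix n) → det R n (λ i j → - M i j) ≈ negOnePow R n * det R n M
  det-neg zero    M = sym (*-identityˡ 1#)
  det-neg (suc n) M = begin
    det R (suc n) (λ i j → - M i j)
      ≡⟨ det-laplace n (λ i j → - M i j) ⟩
    ∑[ j < suc n ] (sgn j * (- M zero j * det R n (λ i l → - minor j M i l)))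
      ≈⟨ sum-cong-≋ (λ j → *-congˡ {sgn j} (*-congˡ { - M zero j} (det-neg n (minor j M)))) ⟩
    ∑[ j < suc n ] (sgn j * (- M zero j * (ε * d j)))
      ≈⟨ sum-cong-≋ (λ j → regroup (sgn j) (M zero j) ε (d j)) ⟩
    ∑[ j < suc n ] (- ε * (sgn j * (M zero j * d j)))
      ≈⟨ *-distribˡ-sum (- ε) (λ j → sgn j * (M zero j * d j)) ⟨
    - ε * ∑[ j < suc n ] (sgn j * (M zero j * d j))
      ≡⟨ ≡.cong (- ε *_) (det-laplace n M) ⟨
    negOnePow R (suc n) * det R (suc n) M ∎
    where
    ε : Carrier
    ε = negOnePow R n
    d : Fin (suc n) → Carrier
    d j = det R n (minor j M)
    regroup : ∀ s x e y → s * (- x * (e * y)) ≈ - e * (s * (x * y))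
    regroup s x e y = trans (x∙yz≈y∙xz s (- x) (e * y)) (-‿*-cong
      (solve 4 (λ s x e y → x ⊗ (s ⊗ (e ⊗ y)) ⊜ e ⊗ (s ⊗ (x ⊗ y))) refl s x e y))

  det-expand-column₀ : ∀ n (M : Matrix (suc n)) →
    det R (suc n) M ≈ ∑[ i < suc n ] (sgn i * (M i zero * det R n (minor i (M ᵀ) ᵀ)))
  det-expand-column₀ zero    M = refl
  det-expand-column₀ (suc n) M = begin
    det R (suc (suc n)) M
      ≡⟨ det-laplace (suc n) M ⟩
    t₀ + ∑[ j < suc n ] (- sgn j * (x j * det R (suc n) (minor (suc j) M)))
      ≈⟨ +-congˡ (sum-cong-≋ λ j →
           *-congˡ { - sgn j} (*-congˡ {x j} (det-expand-column₀ n (minor (suc j) M)))) ⟩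
    t₀ + ∑[ j < suc n ] (- sgn j * (x j * ∑[ i < suc n ] (sgn i * (y i * E i j))))
      ≈⟨ +-congˡ (sum-cong-≋ λ j → *-*-distribˡ-sum (- sgn j) (x j) (λ i → sgn i * (y i * E i j))) ⟩
    t₀ + ∑[ j < suc n ] ∑[ i < suc n ] (- sgn j * (x j * (sgn i * (y i * E i j))))
      ≈⟨ +-congˡ (∑-comm (λ j i → - sgn j * (x j * (sgn i * (y i * E i j))))) ⟩
    t₀ + ∑[ i < suc n ] ∑[ j < suc n ] (- sgn j * (x j * (sgn i * (y i * E i j))))
      ≈⟨ +-congˡ (sum-cong-≋ λ i → sum-cong-≋ λ j → exchange (sgn j) (x j) (sgn i) (y i) (E i j)) ⟩
    t₀ + ∑[ i < suc n ] ∑[ j < suc n ] (- sgn i * (y i * (sgn j * (x j * E i j))))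
      ≈⟨ +-congˡ (sum-cong-≋ λ i → *-*-distribˡ-sum (- sgn i) (y i) (λ j → sgn j * (x j * E i j))) ⟨
    t₀ + ∑[ i < suc n ] (- sgn i * (y i * ∑[ j < suc n ] (sgn j * (x j * E i j))))
      ≡⟨ ≡.cong (t₀ +_) (sum-cong-≗ λ i →
           ≡.cong (λ e → - sgn i * (y i * e)) (det-laplace n (minor (suc i) (M ᵀ) ᵀ))) ⟨
    ∑[ i < suc (suc n) ] (sgn i * (M i zero * det R (suc n) (minor i (M ᵀ) ᵀ))) ∎
    where
    t₀ : Carrier
    t₀ = 1# * (M zero zero * det R (suc n) (minor zero M))
    x y : Fin (suc n) → Carrier
    x j = M zero (suc j)
    y i = M (suc i) zero
    E : Fin (suc n) → Fin (suc n) → Carrier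
    E i j = det R n (λ r c → M (suc (punchIn i r)) (suc (punchIn j c)))
    exchange : ∀ a x b y e → - a * (x * (b * (y * e))) ≈ - b * (y * (a * (x * e)))
    exchange a x b y e = -‿*-cong
      (solve 5 (λ a x b y e → a ⊗ (x ⊗ (b ⊗ (y ⊗ e))) ⊜ b ⊗ (y ⊗ (a ⊗ (x ⊗ e)))) refl a x b y e)

  det-transpose : ∀ n (M : Matrix n) → det R n (M ᵀ) ≈ det R n M
  det-transpose zero    M = refl
  det-transpose (suc n) M = begin
    det R (suc n) (M ᵀ)
      ≡⟨ det-laplace n (M ᵀ) ⟩
    ∑[ i < suc n ] (sgn i * (M i zero * det R n (minor i (M ᵀ))))
      ≈⟨ sum-cong-≋ (λ i → *-congˡ {sgn i} (*-congˡ {M i zero}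
           (sym (det-transpose n (minor i (M ᵀ)))))) ⟩
    ∑[ i < suc n ] (sgn i * (M i zero * det R n (minor i (M ᵀ) ᵀ)))
      ≈⟨ det-expand-column₀ n M ⟨
    det R (suc n) M ∎

  det-column₀-zero-below : ∀ n (M : Matrix (suc n)) → (∀ i → M (suc i) zero ≈ 0#) →
    det R (suc n) M ≈ M zero zero * det R n (minor zero M)
  det-column₀-zero-below n M column≈0 = begin
    det R (suc n) M
      ≈⟨ det-expand-column₀ n M ⟩
    1# * (M zero zero * det R n (minor zero M)) + ∑[ i < n ] rest i
      ≈⟨ +-cong (*-identityˡ _) (sum-zero n λ i →
           trans (*-congˡ (trans (*-congʳ (column≈0 i)) (zeroˡ _))) (zeroʳ _)) ⟩
    M zero zero * det R n (minor zero M) + 0#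
      ≈⟨ +-identityʳ _ ⟩
    M zero zero * det R n (minor zero M) ∎
    where
    rest : Fin n → Carrier
    rest i = - sgn i * (M (suc i) zero * det R n (minor (suc i) (M ᵀ) ᵀ))

  Row-pair-weight : ℕ → Set r
  Row-pair-weight m = Fin (suc (suc m)) → Fin (suc (suc m)) → Carrier

  Complementary-minor : ℕ → Set r
  Complementary-minor m = (Fin m → Fin (suc (suc m))) → Carrier

  -- Expansion along the first two rows, abstracted over the row pair (B = rows₀₁ M) and the
  -- complementary minors (Φ = minor₀₁ M) so that expand₂-symmetric can recurse on both.
  expand₂-term : ∀ m → Row-pair-weight m → Complementary-minor m →
    Fin (suc (suc m)) → Fin (suc m) → Carrier
  expand₂-term m B Φ j l = (sgn j * sgn l) * (B j (punchIn j l) * Φ (punchIn j ∘ punchIn l))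

  expand₂ : ∀ m → Row-pair-weight m → Complementary-minor m → Carrier
  expand₂ m B Φ = ∑[ j < suc (suc m) ] ∑[ l < suc m ] expand₂-term m B Φ j l

  rows₀₁ : ∀ {m} → Matrix (suc (suc m)) → Row-pair-weight m
  rows₀₁ M x y = M zero x * M (suc zero) y

  minor₀₁ : ∀ {m} → Matrix (suc (suc m)) → Complementary-minor m
  minor₀₁ {m} M h = det R m (λ i c → M (suc (suc i)) (h c))

  minor₀₁-resp : ∀ {m} (M : Matrix (suc (suc m))) {h g} → h ≗ g → minor₀₁ M h ≈ minor₀₁ M g
  minor₀₁-resp {m} M h≗g = det-cong m (λ i c → reflexive (≡.cong (M (suc (suc i))) (h≗g c)))

  det≈expand₂ : ∀ m (M : Matrix (suc (suc m))) →
    det R (suc (suc m)) M ≈ expand₂ m (rows₀₁ M) (minor₀₁ M)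
  det≈expand₂ m M = begin
    det R (suc (suc m)) M
      ≡⟨ det-laplace (suc m) M ⟩
    ∑[ j < suc (suc m) ] (sgn j * (M zero j * det R (suc m) (minor j M)))
      ≡⟨ sum-cong-≗ (λ j → ≡.cong (λ e → sgn j * (M zero j * e)) (det-laplace m (minor j M))) ⟩
    ∑[ j < suc (suc m) ] (sgn j * (M zero j * ∑[ l < suc m ] (sgn l * (M₁ j l * Φ j l))))
      ≈⟨ sum-cong-≋ (λ j → *-*-distribˡ-sum (sgn j) (M zero j) (λ l → sgn l * (M₁ j l * Φ j l))) ⟩
    ∑[ j < suc (suc m) ] ∑[ l < suc m ] (sgn j * (M zero j * (sgn l * (M₁ j l * Φ j l))))
      ≈⟨ sum-cong-≋ (λ j → sum-cong-≋ λ l → regroup (sgn j) (M zero j) (sgn l) (M₁ j l) (Φ j l)) ⟩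
    expand₂ m (rows₀₁ M) (minor₀₁ M) ∎
    where
    M₁ Φ : Fin (suc (suc m)) → Fin (suc m) → Carrier
    M₁ j l = M (suc zero) (punchIn j l)
    Φ j l = det R m (minor l (minor j M))
    regroup : ∀ a x b y p → a * (x * (b * (y * p))) ≈ (a * b) * ((x * y) * p)
    regroup = solve 5 (λ a x b y p → a ⊗ (x ⊗ (b ⊗ (y ⊗ p))) ⊜ (a ⊗ b) ⊗ ((x ⊗ y) ⊗ p)) refl

  expand₂-+ : ∀ m B B′ Φ →
    expand₂ m B Φ + expand₂ m B′ Φ ≈ expand₂ m (λ x y → B x y + B′ x y) Φ
  expand₂-+ m B B′ Φ = begin
    expand₂ m B Φ + expand₂ m B′ Φ
      ≈⟨ ∑-distrib-+ (λ j → ∑[ l < suc m ] T j l) (λ j → ∑[ l < suc m ] T′ j l) ⟨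
    ∑[ j < suc (suc m) ] (∑[ l < suc m ] T j l + ∑[ l < suc m ] T′ j l)
      ≈⟨ sum-cong-≋ (λ j → ∑-distrib-+ (T j) (T′ j)) ⟨
    ∑[ j < suc (suc m) ] ∑[ l < suc m ] (T j l + T′ j l)
      ≈⟨ sum-cong-≋ (λ j → sum-cong-≋ λ l →
           factor (sgn j * sgn l) (B j (punchIn j l)) (B′ j (punchIn j l)) (Φ (punchIn j ∘ punchIn l))) ⟩
    expand₂ m (λ x y → B x y + B′ x y) Φ ∎
    where
    T T′ : Fin (suc (suc m)) → Fin (suc m) → Carrier
    T  = expand₂-term m B Φ
    T′ = expand₂-term m B′ Φ
    factor : ∀ s x y p → s * (x * p) + s * (y * p) ≈ s * ((x + y) * p)
    factor s x y p = sym (trans (*-congˡ (distribʳ p x y)) (distribˡ s (x * p) (y * p)))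

  -- By the symmetry of B, the terms with j = 0 cancel against those with l = 0.
  expand₂-peel : ∀ m B Φ → (∀ x y → B x y ≈ B y x) →
    expand₂ m B Φ ≈ ∑[ j < suc m ] ∑[ l < m ] expand₂-term m B Φ (suc j) (suc l)
  expand₂-peel m B Φ B-sym = begin
    ∑[ l < suc m ] T zero l + ∑[ j < suc m ] (T (suc j) zero + ∑[ l < m ] T (suc j) (suc l))
      ≈⟨ +-congˡ (∑-distrib-+ (λ j → T (suc j) zero) (λ j → ∑[ l < m ] T (suc j) (suc l))) ⟩
    ∑[ l < suc m ] T zero l + (∑[ j < suc m ] T (suc j) zero + rest)
      ≈⟨ +-assoc _ _ rest ⟨
    ∑[ l < suc m ] T zero l + ∑[ j < suc m ] T (suc j) zero + rest
      ≈⟨ +-congʳ (∑-distrib-+ (T zero) (λ l → T (suc l) zero)) ⟨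
    ∑[ l < suc m ] (T zero l + T (suc l) zero) + rest
      ≈⟨ +-congʳ (sum-zero (suc m) cancel) ⟩
    0# + rest
      ≈⟨ +-identityˡ rest ⟩
    rest ∎
    where
    T : Fin (suc (suc m)) → Fin (suc m) → Carrier
    T = expand₂-term m B Φ
    rest : Carrier
    rest = ∑[ j < suc m ] ∑[ l < m ] T (suc j) (suc l)
    cancel : ∀ l → T zero l + T (suc l) zero ≈ 0#
    cancel l = begin
      T zero l + T (suc l) zero
        ≈⟨ +-cong (*-congʳ (*-identityˡ (sgn l)))
                  (*-cong (*-identityʳ (- sgn l)) (*-congʳ (B-sym (suc l) zero))) ⟩
      sgn l * X + - sgn l * X
        ≈⟨ +-congˡ (-‿distribˡ-* (sgn l) X) ⟨
      sgn l * X + - (sgn l * X)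
        ≈⟨ -‿inverseʳ (sgn l * X) ⟩
      0# ∎
      where
      X : Carrier
      X = B zero (suc l) * Φ (λ c → suc (punchIn l c))

  expand₂-symmetric : ∀ m B Φ → (∀ x y → B x y ≈ B y x) → (∀ {h g} → h ≗ g → Φ h ≈ Φ g) →
    expand₂ m B Φ ≈ 0#
  expand₂-symmetric zero    B Φ B-sym Φ-resp = trans (expand₂-peel zero B Φ B-sym) (+-identityˡ 0#)
  expand₂-symmetric (suc m) B Φ B-sym Φ-resp = begin
    expand₂ (suc m) B Φ
      ≈⟨ expand₂-peel (suc m) B Φ B-sym ⟩
    ∑[ j < suc (suc m) ] ∑[ l < suc m ] expand₂-term (suc m) B Φ (suc j) (suc l)
      ≈⟨ sum-cong-≋ (λ j → sum-cong-≋ λ l → *-cong (-x*-y≈x*y (sgn j) (sgn l))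
           (*-congˡ {B (suc j) (suc (punchIn j l))} (Φ-resp (punchIn-suc j l)))) ⟩
    expand₂ m B′ Φ′
      ≈⟨ expand₂-symmetric m B′ Φ′ (λ x y → B-sym (suc x) (suc y)) Φ′-resp ⟩
    0# ∎
    where
    B′ : Row-pair-weight m
    B′ x y = B (suc x) (suc y)
    Φ′ : Complementary-minor m
    Φ′ h = Φ (zero ∷ suc ∘ h)
    Φ′-resp : ∀ {h g} → h ≗ g → Φ′ h ≈ Φ′ g
    Φ′-resp h≗g = Φ-resp λ { zero → ≡.refl ; (suc c) → ≡.cong suc (h≗g c) }
    punchIn-suc : ∀ j l → punchIn (suc j) ∘ punchIn (suc l) ≗ zero ∷ suc ∘ punchIn j ∘ punchIn l
    punchIn-suc j l zero    = ≡.refl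
    punchIn-suc j l (suc c) = ≡.refl

  det-equal-rows₀₁ : ∀ m (M : Matrix (suc (suc m))) → (∀ j → M zero j ≈ M (suc zero) j) →
    det R (suc (suc m)) M ≈ 0#
  det-equal-rows₀₁ m M rows≈ = trans (det≈expand₂ m M) (expand₂-symmetric m (rows₀₁ M) (minor₀₁ M)
    (λ x y → trans (*-cong (rows≈ x) (sym (rows≈ y))) (*-comm _ _)) (minor₀₁-resp M))

  swap₀₁ : ∀ {m} → Matrix (suc (suc m)) → Matrix (suc (suc m))
  swap₀₁ M zero          = M (suc zero)
  swap₀₁ M (suc zero)    = M zero
  swap₀₁ M (suc (suc i)) = M (suc (suc i))

  det-swap₀₁ : ∀ m (M : Matrix (suc (suc m))) → det R (suc (suc m)) M ≈ - det R (suc (suc m)) (swap₀₁ M)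
  det-swap₀₁ m M = +-inverseˡ-unique _ _ (begin
    det R (suc (suc m)) M + det R (suc (suc m)) (swap₀₁ M)
      ≈⟨ +-cong (det≈expand₂ m M) (det≈expand₂ m (swap₀₁ M)) ⟩
    expand₂ m (rows₀₁ M) (minor₀₁ M) + expand₂ m (rows₀₁ (swap₀₁ M)) (minor₀₁ M)
      ≈⟨ expand₂-+ m (rows₀₁ M) (rows₀₁ (swap₀₁ M)) (minor₀₁ M) ⟩
    expand₂ m B (minor₀₁ M)
      ≈⟨ expand₂-symmetric m B (minor₀₁ M) (λ x y → trans (+-comm _ _) (+-cong (*-comm _ _) (*-comm _ _)))
                                           (minor₀₁-resp M) ⟩
    0# ∎)
    where
    B : Row-pair-weight m
    B x y = rows₀₁ M x y + rows₀₁ (swap₀₁ M) x y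

  det-linear-row₀ : ∀ n (x y : Fin (suc n) → Carrier) a (W : Fin n → Fin (suc n) → Carrier) →
    det R (suc n) ((λ j → x j + a * y j) ∷ W) ≈ det R (suc n) (x ∷ W) + a * det R (suc n) (y ∷ W)
  det-linear-row₀ n x y a W = begin
    det R (suc n) ((λ j → x j + a * y j) ∷ W)
      ≡⟨ det-laplace n ((λ j → x j + a * y j) ∷ W) ⟩
    ∑[ j < suc n ] (sgn j * ((x j + a * y j) * d j))
      ≈⟨ sum-cong-≋ (λ j → split (sgn j) (x j) (y j) (d j)) ⟩
    ∑[ j < suc n ] (sgn j * (x j * d j) + a * (sgn j * (y j * d j)))
      ≈⟨ ∑-distrib-+ (λ j → sgn j * (x j * d j)) (λ j → a * (sgn j * (y j * d j))) ⟩
    ∑[ j < suc n ] (sgn j * (x j * d j)) + ∑[ j < suc n ] (a * (sgn j * (y j * d j)))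
      ≈⟨ +-congˡ (*-distribˡ-sum a (λ j → sgn j * (y j * d j))) ⟨
    ∑[ j < suc n ] (sgn j * (x j * d j)) + a * ∑[ j < suc n ] (sgn j * (y j * d j))
      ≡⟨ ≡.cong₂ (λ u v → u + a * v) (det-laplace n (x ∷ W)) (det-laplace n (y ∷ W)) ⟨
    det R (suc n) (x ∷ W) + a * det R (suc n) (y ∷ W) ∎
    where
    d : Fin (suc n) → Carrier
    d j = det R n (λ i l → W i (punchIn j l))
    split : ∀ s u v e → s * ((u + a * v) * e) ≈ s * (u * e) + a * (s * (v * e))
    split s u v e = begin
      s * ((u + a * v) * e)          ≈⟨ *-congˡ (distribʳ e u (a * v)) ⟩
      s * (u * e + a * v * e)        ≈⟨ distribˡ s (u * e) (a * v * e) ⟩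
      s * (u * e) + s * (a * v * e)
        ≈⟨ +-congˡ (solve 4 (λ s a v e → s ⊗ ((a ⊗ v) ⊗ e) ⊜ a ⊗ (s ⊗ (v ⊗ e))) refl s a v e) ⟩
      s * (u * e) + a * (s * (v * e)) ∎

  -- After swapping rows 0 and 1 the source row occurs in every minor of the first row, so the
  -- induction hypothesis applies there; what is left over has two equal rows.
  det-add-row₀ : ∀ n (M N : Matrix (suc n)) (c : Fin n → Carrier) →
    (∀ j → N zero j ≈ M zero j) → (∀ i j → N (suc i) j ≈ M (suc i) j + c i * M zero j) →
    det R (suc n) N ≈ det R (suc n) M
  det-add-row₀ zero    M N c row₀ rows = det-cong-minors zero {N} {M} row₀ (λ _ → refl)
  det-add-row₀ (suc n) M N c row₀ rows = begin
    det R (suc (suc n)) N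
      ≈⟨ det-swap₀₁ n N ⟩
    - det R (suc (suc n)) (swap₀₁ N)
      ≈⟨ -‿cong (det-cong-minors (suc n) {swap₀₁ N} {row₁′ ∷ others} (rows zero) λ j →
           det-add-row₀ n (minor j (swap₀₁ M)) (minor j (swap₀₁ N)) (c ∘ suc) (row₀ ∘ punchIn j)
                        (λ i l → rows (suc i) (punchIn j l))) ⟩
    - det R (suc (suc n)) (row₁′ ∷ others)
      ≈⟨ -‿cong (det-linear-row₀ (suc n) (M (suc zero)) (M zero) (c zero) others) ⟩
    - (det R (suc (suc n)) (swap₀₁ M) + c zero * det R (suc (suc n)) (M zero ∷ others))
      ≈⟨ -‿cong (+-congˡ (trans (*-congˡ (det-equal-rows₀₁ n (M zero ∷ others) (λ _ → refl))) (zeroʳ (c zero)))) ⟩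
    - (det R (suc (suc n)) (swap₀₁ M) + 0#)
      ≈⟨ -‿cong (+-identityʳ _) ⟩
    - det R (suc (suc n)) (swap₀₁ M)
      ≈⟨ det-swap₀₁ n M ⟨
    det R (suc (suc n)) M ∎
    where
    row₁′ : Fin (suc (suc n)) → Carrier
    row₁′ j = M (suc zero) j + c zero * M zero j
    others : Fin (suc n) → Fin (suc (suc n)) → Carrier
    others = swap₀₁ M ∘ suc

  -- Cauchy products

  sumTo : ℕ → (ℕ → Carrier) → Carrier
  sumTo = Defs.sumTo R

  _⋆_ : (ℕ → Carrier) → (ℕ → Carrier) → ℕ → Carrier
  _⋆_ = Defs._⋆_ R

  sumTo-cong : ∀ n {f g : ℕ → Carrier} → (∀ i → i < n → f i ≈ g i) → sumTo n f ≈ sumTo n g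
  sumTo-cong zero    f≈g = refl
  sumTo-cong (suc n) f≈g = +-cong (sumTo-cong n λ i i<n → f≈g i (ℕ.m<n⇒m<1+n i<n)) (f≈g n (ℕ.n<1+n n))

  sumTo-zero : ∀ n {f : ℕ → Carrier} → (∀ i → i < n → f i ≈ 0#) → sumTo n f ≈ 0#
  sumTo-zero zero    f≈0 = refl
  sumTo-zero (suc n) f≈0 =
    trans (+-cong (sumTo-zero n λ i i<n → f≈0 i (ℕ.m<n⇒m<1+n i<n)) (f≈0 n (ℕ.n<1+n n))) (+-identityˡ 0#)

  sumTo-distrib-+ : ∀ n (f g : ℕ → Carrier) → sumTo n (λ i → f i + g i) ≈ sumTo n f + sumTo n g
  sumTo-distrib-+ zero    f g = sym (+-identityˡ 0#)
  sumTo-distrib-+ (suc n) f g = trans (+-congʳ (sumTo-distrib-+ n f g)) (+-interchange _ _ (f n) (g n))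

  *-distribˡ-sumTo : ∀ x n (f : ℕ → Carrier) → x * sumTo n f ≈ sumTo n (λ i → x * f i)
  *-distribˡ-sumTo x zero    f = zeroʳ x
  *-distribˡ-sumTo x (suc n) f = trans (distribˡ x (sumTo n f) (f n)) (+-congʳ (*-distribˡ-sumTo x n f))

  sumTo-suc : ∀ n (f : ℕ → Carrier) → sumTo (suc n) f ≈ f 0 + sumTo n (f ∘ suc)
  sumTo-suc zero    f = +-comm 0# (f 0)
  sumTo-suc (suc n) f = trans (+-congʳ (sumTo-suc n f)) (+-assoc (f 0) (sumTo n (f ∘ suc)) (f (suc n)))

  sumTo-split : ∀ m n (f : ℕ → Carrier) → sumTo (m +ℕ n) f ≈ sumTo m f + sumTo n (λ i → f (m +ℕ i))
  sumTo-split zero    n f = sym (+-identityˡ (sumTo n f))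
  sumTo-split (suc m) n f = begin
    sumTo (suc (m +ℕ n)) f                                      ≈⟨ sumTo-suc (m +ℕ n) f ⟩
    f 0 + sumTo (m +ℕ n) (f ∘ suc)                              ≈⟨ +-congˡ (sumTo-split m n (f ∘ suc)) ⟩
    f 0 + (sumTo m (f ∘ suc) + sumTo n (λ i → f (suc m +ℕ i)))  ≈⟨ +-assoc _ _ _ ⟨
    f 0 + sumTo m (f ∘ suc) + sumTo n (λ i → f (suc m +ℕ i))    ≈⟨ +-congʳ (sumTo-suc m f) ⟨
    sumTo (suc m) f + sumTo n (λ i → f (suc m +ℕ i))            ∎

  sumTo-reverse : ∀ n (f : ℕ → Carrier) → sumTo (suc n) f ≈ sumTo (suc n) (λ i → f (n ∸ i))
  sumTo-reverse zero    f = refl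
  sumTo-reverse (suc n) f = begin
    sumTo (suc n) f + f (suc n)                  ≈⟨ +-congʳ (sumTo-reverse n f) ⟩
    sumTo (suc n) (λ i → f (n ∸ i)) + f (suc n)  ≈⟨ +-comm _ _ ⟩
    f (suc n) + sumTo (suc n) (λ i → f (n ∸ i))  ≈⟨ sumTo-suc (suc n) (λ i → f (suc n ∸ i)) ⟨
    sumTo (suc (suc n)) (λ i → f (suc n ∸ i))    ∎

  ⋆-congˡ : ∀ f {g h : ℕ → Carrier} → (∀ i → g i ≈ h i) → ∀ n → (f ⋆ g) n ≈ (f ⋆ h) n
  ⋆-congˡ f g≈h n = sumTo-cong (suc n) λ i _ → *-congˡ (g≈h (n ∸ i))

  ⋆-comm : ∀ f g n → (f ⋆ g) n ≈ (g ⋆ f) n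
  ⋆-comm f g n = trans (sumTo-reverse n (λ i → f i * g (n ∸ i))) (sumTo-cong (suc n) λ i i<1+n →
    trans (*-comm _ _) (*-congʳ (reflexive (≡.cong g (ℕ.m∸[m∸n]≡n (ℕ.≤-pred i<1+n))))))

  ⋆-identityˡ : ∀ f n → (oneSeries R ⋆ f) n ≈ f n
  ⋆-identityˡ f n = begin
    (oneSeries R ⋆ f) n                            ≈⟨ sumTo-suc n (λ i → oneSeries R i * f (n ∸ i)) ⟩
    1# * f n + sumTo n (λ i → 0# * f (n ∸ suc i))
      ≈⟨ +-cong (*-identityˡ (f n)) (sumTo-zero n λ i _ → zeroˡ _) ⟩
    f n + 0#                                       ≈⟨ +-identityʳ (f n) ⟩
    f n                                            ∎

  ⋆-identityʳ : ∀ f n → (f ⋆ oneSeries R) n ≈ f n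
  ⋆-identityʳ f n = trans (⋆-comm f (oneSeries R) n) (⋆-identityˡ f n)

  ⋆-distribˡ-+ : ∀ f g h n → (f ⋆ (λ i → g i + h i)) n ≈ (f ⋆ g) n + (f ⋆ h) n
  ⋆-distribˡ-+ f g h n = trans (sumTo-cong (suc n) λ i _ → distribˡ (f i) (g (n ∸ i)) (h (n ∸ i)))
                               (sumTo-distrib-+ (suc n) (λ i → f i * g (n ∸ i)) (λ i → f i * h (n ∸ i)))

  ⋆-scalarʳ : ∀ f x g n → (f ⋆ (λ i → x * g i)) n ≈ x * (f ⋆ g) n
  ⋆-scalarʳ f x g n = trans (sumTo-cong (suc n) λ i _ → x∙yz≈y∙xz (f i) x (g (n ∸ i)))
                            (sym (*-distribˡ-sumTo x (suc n) (λ i → f i * g (n ∸ i))))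

  ⋆-suc : ∀ f g n → (f ⋆ g) (suc n) ≈ (f ⋆ (g ∘ suc)) n + f (suc n) * g 0
  ⋆-suc f g n = +-cong
    (sumTo-cong (suc n) λ i i<1+n → *-congˡ (reflexive (≡.cong g (ℕ.+-∸-assoc 1 (ℕ.≤-pred i<1+n)))))
    (*-congˡ (reflexive (≡.cong g (ℕ.n∸n≡0 n))))

  ⋆-split : ∀ f g m k → (f ⋆ g) (m +ℕ k) ≈
    (f ⋆ (λ p → g (p +ℕ k))) m + sumTo k (λ u → f (suc m +ℕ u) * g (k ∸ suc u))
  ⋆-split f g m k = trans (sumTo-split (suc m) k (λ i → f i * g (m +ℕ k ∸ i))) (+-cong
    (sumTo-cong (suc m) λ i i<1+m → *-congˡ (reflexive (≡.cong g (ℕ.+-∸-comm k (ℕ.≤-pred i<1+m)))))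
    (sumTo-cong k λ u _ → *-congˡ (reflexive (≡.cong g (beyond u)))))
    where
    beyond : ∀ u → m +ℕ k ∸ (suc m +ℕ u) ≡ k ∸ suc u
    beyond u = ≡.trans (≡.cong (m +ℕ k ∸_) (≡.sym (ℕ.+-suc m u))) (ℕ.[m+n]∸[m+o]≡n∸o m k (suc u))

  ⋆-shift : ∀ f g m k → (∀ i → i < k → g i ≈ 0#) →
    (f ⋆ g) (m +ℕ k) ≈ (f ⋆ (λ p → g (p +ℕ k))) m
  ⋆-shift f g m k g≈0 = trans (⋆-split f g m k) (trans (+-congˡ (sumTo-zero k λ u u<k →
      trans (*-congˡ (g≈0 (k ∸ suc u) (ℕ.∸-monoʳ-< (s≤s z≤n) u<k))) (zeroʳ _)))
    (+-identityʳ _))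

  -- Row i on the left is ∑_{p ≤ i} t_p A_{i-p}: the matrix (A_p)_p multiplied on the left by the
  -- lower triangular Toeplitz matrix of t, which is unitriangular.
  det-toeplitz : ∀ {t : ℕ → Carrier} → t 0 ≈ 1# → ∀ n (A : ℕ → Fin n → Carrier) →
    det R n (λ i j → (t ⋆ (λ p → A p j)) (toℕ i)) ≈ det R n (λ i → A (toℕ i))
  det-toeplitz         t₀≈1 zero    A = refl
  det-toeplitz {t = t} t₀≈1 (suc n) A = begin
    det R (suc n) TA
      ≈⟨ det-add-row₀ n M TA (λ i → t (suc (toℕ i))) row₀ rows ⟩
    det R (suc n) M
      ≈⟨ det-cong-minors n {M} {λ i → A (toℕ i)} (λ _ → refl) (λ j →
           det-toeplitz t₀≈1 n (λ p l → A (suc p) (punchIn j l))) ⟩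
    det R (suc n) (λ i → A (toℕ i)) ∎
    where
    TA M : Matrix (suc n)
    TA i j = (t ⋆ (λ p → A p j)) (toℕ i)
    M = A 0 ∷ (λ i j → (t ⋆ (λ p → A (suc p) j)) (toℕ i))
    row₀ : ∀ j → (t ⋆ (λ p → A p j)) 0 ≈ A 0 j
    row₀ j = trans (+-identityˡ _) (trans (*-congʳ t₀≈1) (*-identityˡ (A 0 j)))
    rows : ∀ i j → (t ⋆ (λ p → A p j)) (suc (toℕ i)) ≈
                   (t ⋆ (λ p → A (suc p) j)) (toℕ i) + t (suc (toℕ i)) * A 0 j
    rows i j = ⋆-suc t (λ p → A p j) (toℕ i)

  -- The numbers a_{n,k} of a constant sequence

  module _ (c : Carrier) where

    a : ℕ → ℕ → Carrier
    a = aSeq R (constSeq R c)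

    x+c0+0≈x : ∀ x → x + c * 0# + 0# ≈ x
    x+c0+0≈x x = trans (+-identityʳ _) (trans (+-congˡ (zeroʳ c)) (+-identityʳ x))

    a-below-diagonal : ∀ {n k} → n < k → a n k ≈ 0#
    a-below-diagonal {zero}  {suc k} _          = refl
    a-below-diagonal {suc n} {suc k} (s≤s n<k) = trans
      (+-cong (+-cong (a-below-diagonal n<k) (*-congˡ (a-below-diagonal (ℕ.m<n⇒m<1+n n<k))))
              (a-below-diagonal (ℕ.m<n⇒m<1+n (ℕ.m<n⇒m<1+n n<k))))
      (x+c0+0≈x 0#)

    a-diagonal : ∀ k → a k k ≈ 1#
    a-diagonal zero    = refl
    a-diagonal (suc k) = trans
      (+-cong (+-cong (a-diagonal k) (*-congˡ (a-below-diagonal (ℕ.n<1+n k))))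
              (a-below-diagonal (ℕ.m<n⇒m<1+n (ℕ.n<1+n k))))
      (x+c0+0≈x 1#)

    -- Splitting a path to height j + 1 at its last visit to height 0: since the sequence is
    -- constant, the part after it is a path to height j lifted by one.
    a-suc-suc : ∀ n j → a (suc n) (suc j) ≈ (Aser R c ⋆ (λ m → a m j)) n
    a-suc-suc zero    j = trans (x+c0+0≈x (a 0 j)) (sym (trans (+-identityˡ _) (*-identityˡ (a 0 j))))
    a-suc-suc (suc n) zero = begin
      a (suc n) 0 + c * a (suc n) 1 + a (suc n) 2
        ≈⟨ +-cong (+-congˡ (*-congˡ (a-suc-suc n 0))) (a-suc-suc n 1) ⟩
      a (suc n) 0 + c * (A ⋆ column 0) n + (A ⋆ column 1) n
        ≈⟨ +-assoc _ _ _ ⟩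
      a (suc n) 0 + (c * (A ⋆ column 0) n + (A ⋆ column 1) n)
        ≈⟨ +-congˡ (+-congʳ (⋆-scalarʳ A c (column 0) n)) ⟨
      a (suc n) 0 + ((A ⋆ (λ m → c * a m 0)) n + (A ⋆ column 1) n)
        ≈⟨ +-congˡ (⋆-distribˡ-+ A (λ m → c * a m 0) (column 1) n) ⟨
      a (suc n) 0 + (A ⋆ (column 0 ∘ suc)) n
        ≈⟨ trans (+-congˡ (*-identityʳ _)) (+-comm _ _) ⟨
      (A ⋆ (column 0 ∘ suc)) n + A (suc n) * a 0 0
        ≈⟨ ⋆-suc A (column 0) n ⟨
      (A ⋆ column 0) (suc n) ∎
      where
      A : ℕ → Carrier
      A = Aser R c
      column : ℕ → ℕ → Carrier
      column j m = a m j
    a-suc-suc (suc n) (suc j) = begin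
      a (suc n) (suc j) + c * a (suc n) (suc (suc j)) + a (suc n) (suc (suc (suc j)))
        ≈⟨ +-cong (+-cong (a-suc-suc n j) (*-congˡ (a-suc-suc n (suc j)))) (a-suc-suc n (suc (suc j))) ⟩
      (A ⋆ column j) n + c * (A ⋆ column (suc j)) n + (A ⋆ column (suc (suc j))) n
        ≈⟨ +-congʳ (+-congˡ (⋆-scalarʳ A c (column (suc j)) n)) ⟨
      (A ⋆ column j) n + (A ⋆ (λ m → c * a m (suc j))) n + (A ⋆ column (suc (suc j))) n
        ≈⟨ +-congʳ (⋆-distribˡ-+ A (column j) (λ m → c * a m (suc j)) n) ⟨
      (A ⋆ (λ m → a m j + c * a m (suc j))) n + (A ⋆ column (suc (suc j))) n
        ≈⟨ ⋆-distribˡ-+ A (λ m → a m j + c * a m (suc j)) (column (suc (suc j))) n ⟨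
      (A ⋆ (column (suc j) ∘ suc)) n
        ≈⟨ trans (+-congˡ (zeroʳ _)) (+-identityʳ _) ⟨
      (A ⋆ (column (suc j) ∘ suc)) n + A (suc n) * a 0 (suc j)
        ≈⟨ ⋆-suc A (column (suc j)) n ⟨
      (A ⋆ column (suc j)) (suc n) ∎
      where
      A : ℕ → Carrier
      A = Aser R c
      column : ℕ → ℕ → Carrier
      column j m = a m j

    powSeries-Aser : ∀ k m → powSeries R (Aser R c) (suc k) m ≈ a (m +ℕ k) k
    powSeries-Aser zero    m =
      trans (⋆-identityʳ (Aser R c) m) (reflexive (≡.cong (λ n → a n 0) (≡.sym (ℕ.+-identityʳ m))))
    powSeries-Aser (suc k) m = begin
      (Aser R c ⋆ powSeries R (Aser R c) (suc k)) m
        ≈⟨ ⋆-congˡ (Aser R c) (powSeries-Aser k) m ⟩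
      (Aser R c ⋆ (λ i → a (i +ℕ k) k)) m
        ≈⟨ ⋆-shift (Aser R c) (λ i → a i k) m k (λ i → a-below-diagonal) ⟨
      (Aser R c ⋆ (λ i → a i k)) (m +ℕ k)
        ≈⟨ a-suc-suc (m +ℕ k) k ⟨
      a (suc (m +ℕ k)) (suc k)
        ≡⟨ ≡.cong (λ n → a n (suc k)) (ℕ.+-suc m k) ⟨
      a (m +ℕ suc k) (suc k) ∎

  -- Hankel determinants of reciprocal series

  hankel-reciprocal : ∀ {f b : ℕ → Carrier} → f 0 ≈ 1# → (∀ n → (f ⋆ b) n ≈ oneSeries R n) → ∀ n →
    det R (suc n) (λ i j → b (toℕ i +ℕ toℕ j)) ≈
    negOnePow R n * det R n (λ i j → f (toℕ i +ℕ toℕ j +ℕ 2))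
  hankel-reciprocal {f} {b} f₀≈1 f⋆b≈1 n = begin
    det R (suc n) (λ i j → b (toℕ i +ℕ toℕ j))
      ≈⟨ det-toeplitz f₀≈1 (suc n) (λ p j → b (p +ℕ toℕ j)) ⟨
    det R (suc n) K
      ≈⟨ det-column₀-zero-below n K (λ i → trans
           (⋆-congˡ f (λ p → reflexive (≡.cong b (ℕ.+-identityʳ p))) (suc (toℕ i))) (f⋆b≈1 (suc (toℕ i)))) ⟩
    K zero zero * det R n (minor zero K)
      ≈⟨ trans (*-congʳ (f⋆b≈1 0)) (*-identityˡ _) ⟩
    det R n (minor zero K)
      ≈⟨ det-transpose n (minor zero K) ⟨
    det R n (minor zero K ᵀ)
      ≈⟨ det-cong n (λ r c → tail-entry (toℕ c) (toℕ r)) ⟩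
    det R n (λ r c → - (b ⋆ (λ p → F p c)) (toℕ r))
      ≈⟨ det-neg n (λ r c → (b ⋆ (λ p → F p c)) (toℕ r)) ⟩
    negOnePow R n * det R n (λ r c → (b ⋆ (λ p → F p c)) (toℕ r))
      ≈⟨ *-congˡ (det-toeplitz b₀≈1 n F) ⟩
    negOnePow R n * det R n (λ r → F (toℕ r))
      ≈⟨ *-congˡ (det-cong n λ r c → reflexive (≡.cong f (index (toℕ r) (toℕ c)))) ⟩
    negOnePow R n * det R n (λ i j → f (toℕ i +ℕ toℕ j +ℕ 2)) ∎
    where
    K : Matrix (suc n)
    K i j = (f ⋆ (λ p → b (p +ℕ toℕ j))) (toℕ i)
    F : ℕ → Fin n → Carrier
    F p c = f (suc (suc (toℕ c +ℕ p)))
    b₀≈1 : b 0 ≈ 1#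
    b₀≈1 = begin
      b 0        ≈⟨ *-identityˡ (b 0) ⟨
      1# * b 0   ≈⟨ *-congʳ f₀≈1 ⟨
      f 0 * b 0  ≈⟨ +-identityˡ _ ⟨
      (f ⋆ b) 0  ≈⟨ f⋆b≈1 0 ⟩
      1#         ∎
    -- The coefficient (f ⋆ b)_{c+r+2} = 0, split after its first c + 2 terms.
    tail-entry : ∀ c r →
      (f ⋆ (λ p → b (p +ℕ suc r))) (suc c) ≈ - (b ⋆ (λ p → f (suc (suc (c +ℕ p))))) r
    tail-entry c r = trans
      (+-inverseˡ-unique _ _ (trans (sym (⋆-split f b (suc c) (suc r))) (f⋆b≈1 (suc c +ℕ suc r))))
      (-‿cong (⋆-comm (λ p → f (suc (suc (c +ℕ p)))) b r))
    index : ∀ r c → suc (suc (c +ℕ r)) ≡ r +ℕ c +ℕ 2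
    index r c = ≡.trans (≡.cong (2 +ℕ_) (ℕ.+-comm c r)) (ℕ.+-comm 2 (r +ℕ c))

open import Data.Nat using (_+_)

theorem3 : {r ℓ : Level} (R : CommutativeRing r ℓ) (c : CommutativeRing.Carrier R)
    (k : ℕ) (b : ℕ → CommutativeRing.Carrier R) → IsInvPowA R c k b →
    (n : ℕ) →
    CommutativeRing._≈_ R
      (det R (suc n) (λ i j → b (toℕ i + toℕ j)))
      (CommutativeRing._*_ R (negOnePow R n) (D R (k + 2) k n (constSeq R c)))
theorem3 R c k b b-inverse n = trans
  (hankel-reciprocal R {f} {b} f₀≈1 b-inverse n)
  (*-congˡ (det-cong R n λ i j → f≈a (toℕ i + toℕ j)))
  where
  open CommutativeRing R using (_≈_; 1#; trans; reflexive; *-congˡ)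
  f : ℕ → CommutativeRing.Carrier R
  f = powSeries R (Aser R c) (suc k)
  f₀≈1 : f 0 ≈ 1#
  f₀≈1 = trans (powSeries-Aser R c k 0) (a-diagonal R c k)
  f≈a : ∀ m → f (m + 2) ≈ a R c (m + (k + 2)) k
  f≈a m = trans (powSeries-Aser R c k (m + 2)) (reflexive (≡.cong (λ m′ → a R c m′ k) m+2+k≡m+[k+2]))
    where
    m+2+k≡m+[k+2] : m + 2 + k ≡ m + (k + 2)
    m+2+k≡m+[k+2] = ≡.trans (ℕ.+-assoc m 2 k) (≡.cong (m +_) (ℕ.+-comm 2 k))
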